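{- Let $N\ge0$ be an integer and let $c_1,\dots,c_{N+1}\in\mathbb{Z}$ satisfy $c_1+\cdots+c_k\ge1$ for all $1\le k\le N+1$ and $c_1\ge2$. Consider the linear recurrence $Q_n=\sum_{k=1}^{N+1}c_kQ_{n-k}$ for $n\ge N+2$. Then there exist non-negative integers $e_1,\dots,e_N$ and $b$ (with $e_1\ge1$ when $N\ge1$), the Zeckendorf collection $\mathcal{E}$ for positive integers whose immediate predecessors are $\hat\beta^n=\sum_{k=1}^{n-1}e_k\beta^{n-k}$ for $2\le n\le N+1$ and $\hat\beta^n=\sum_{k=1}^{n-N-1}b\beta^k+\sum_{k=1}^{N}e_k\beta^{n-k}$ for $n\ge N+2$, and initial values $(Q_1,\dots,Q_{N+1})$ such that the sequence $Q$ of positive integers defined by these initial values and the recurrence is a fundamental sequence for $\mathbb{N}$ under $\mathcal{E}$.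
   Context: $\mathbb{N}=\{1,2,3,\dots\}$. A coefficient function is a map $\epsilon:\mathbb{N}\to\{0,1,2,\dots\}$; $\sum\epsilon Q=\sum_k\epsilon_kQ_k$; $\beta^i$ has $\beta^i_i=1$ and $0$ elsewhere. $\mathrm{res}_J(\epsilon)=\sum_{k\in J}\epsilon_k\beta^k$; "$\epsilon\equiv\mu$ on $J$" means $\epsilon_k=\mu_k$ for $k\in J$. $\mu<_a\mu'$ (for finite-support functions) means at the largest index $k$ where they differ, $\mu_k<\mu'_k$. An ascendingly-ordered collection is a set $\mathcal{E}$ of finite-support coefficient functions containing $0$ and all $\beta^i$, ordered by $<_a$; $\hat\beta^n$ denotes the immediate predecessor (largest smaller element) of $\beta^n$. $\mathcal{E}$ is Zeckendorf for positive integers if (1) each $\mu\in\mathcal{E}$ has finitely many elements below it and (2) for each $\mu\in\mathcal{E}$, if its immediate successor (smallest greater element) $\tilde\mu$ is not $\beta^1+\mu$, then there is $n\ge2$ with $\mu\equiv\hat\beta^n$ on $[1,n)$ and $\tilde\mu=\beta^n+\mathrm{res}_{[n,\infty)}(\mu)$. Given prescribed $\hat\beta^n$ of order $n-1$ (order = largest nonzero index), there is exactly one such Zeckendorf collection. A sequence $Q$ in $\mathbb{N}$ is a fundamental sequence for $\mathbb{N}$ under $\mathcal{E}$ if the values $\sum\delta Q$ ($\delta\in\mathcal{E}$) are pairwise distinct and $\{\sum\delta Q:\delta\in\mathcal{E},\delta\ne0\}=\mathbb{N}$. -}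

module Defs where

open import Data.Nat using (ℕ; zero; suc; _+_; _*_; _∸_; _≤_; _<_; _≤ᵇ_; _≡ᵇ_)
open import Data.Bool using (if_then_else_)
open import Data.Integer as ℤ using (ℤ; +_)
open import Data.List using (List)
open import Data.List.Relation.Unary.Any using (Any)
open import Data.Product using (Σ; ∃; _×_; _,_)
open import Data.Sum using (_⊎_)
open import Relation.Nullary using (¬_)
open import Relation.Binary.PropositionalEquality using (_≡_)

-- Coefficient functions ε : ℕ → {0,1,2,...}.  The paper's ℕ = {1,2,3,...};
-- we use Agda's ℕ as index set and require index 0 to carry coefficient 0
-- (see `Valid`), so only indices ≥ 1 matter.
Coef : Set
Coef = ℕ → ℕ

_≗_ : Coef → Coef → Set
μ ≗ ν = ∀ k → μ k ≡ ν k

FinSupp : Coef → Set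
FinSupp μ = ∃ λ M → ∀ k → M < k → μ k ≡ 0

Valid : Coef → Set
Valid μ = (μ 0 ≡ 0) × FinSupp μ

zeroC : Coef
zeroC _ = 0

β : ℕ → Coef
β i k = if i ≡ᵇ k then 1 else 0

_⊕_ : Coef → Coef → Coef
(μ ⊕ ν) k = μ k + ν k

resFrom : ℕ → Coef → Coef
resFrom n μ k = if n ≤ᵇ k then μ k else 0

_<a_ : Coef → Coef → Set
μ <a ν = ∃ λ k → (μ k < ν k) × (∀ j → k < j → μ j ≡ ν j)

Collection : Set₁
Collection = Coef → Set

AscCollection : Collection → Set
AscCollection E =
  (∀ μ → E μ → Valid μ) × E zeroC × (∀ i → 1 ≤ i → E (β i))

IsImmPred : Collection → Coef → ℕ → Set
IsImmPred E ν n =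
  E ν × ν <a β n × (∀ μ → E μ → μ <a β n → (μ ≗ ν ⊎ μ <a ν))

IsImmSucc : Collection → Coef → Coef → Set
IsImmSucc E μ μ~ =
  E μ~ × μ <a μ~ × (∀ ν → E ν → μ <a ν → (μ~ ≗ ν ⊎ μ~ <a ν))

Zeckendorf : Collection → Set
Zeckendorf E =
  AscCollection E ×
  (∀ μ → E μ → ∃ λ (L : List Coef) → ∀ μ' → E μ' → μ' <a μ → Any (μ' ≗_) L) ×
  (∀ μ μ~ → E μ → IsImmSucc E μ μ~ → ¬ (μ~ ≗ (β 1 ⊕ μ)) →
     ∃ λ n → (2 ≤ n) × ∃ λ ν → IsImmPred E ν n ×
       (∀ k → 1 ≤ k → k < n → μ k ≡ ν k) ×
       (μ~ ≗ (β n ⊕ resFrom n μ)))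

sumTo : ℕ → Coef → (ℕ → ℕ) → ℕ
sumTo zero δ Q = 0
sumTo (suc M) δ Q = sumTo M δ Q + δ (suc M) * Q (suc M)

SumIs : Coef → (ℕ → ℕ) → ℕ → Set
SumIs δ Q v = ∃ λ M → (∀ k → M < k → δ k ≡ 0) × (sumTo M δ Q ≡ v)

Fundamental : Collection → (ℕ → ℕ) → Set
Fundamental E Q =
  (∀ δ δ' v → E δ → E δ' → SumIs δ Q v → SumIs δ' Q v → δ ≗ δ') ×
  (∀ δ v → E δ → ¬ (δ ≗ zeroC) → SumIs δ Q v → 1 ≤ v) ×
  (∀ m → 1 ≤ m → ∃ λ δ → E δ × ¬ (δ ≗ zeroC) × SumIs δ Q m)

-- the prescribed immediate predecessors:
--   β̂^n = Σ_{k=1}^{n-1} e_k β^{n-k}                          (2 ≤ n ≤ N+1)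
--   β̂^n = Σ_{k=1}^{n-N-1} b β^k + Σ_{k=1}^{N} e_k β^{n-k}    (n ≥ N+2)
-- i.e. coefficient at index j (1 ≤ j < n) is e_{n-j} if n-j ≤ N, else b
-- (the latter only occurs when n ≥ N+2 and j ≤ n-N-1); 0 otherwise.
hatβ : ℕ → (ℕ → ℕ) → ℕ → ℕ → Coef
hatβ N e b n j =
  if (1 ≤ᵇ j) Data.Bool.∧ (suc j ≤ᵇ n)
  then (if (n ∸ j) ≤ᵇ N then e (n ∸ j) else b)
  else 0

zsum : ℕ → (ℕ → ℤ) → ℤ
zsum zero f = + 0
zsum (suc K) f = zsum K f ℤ.+ f (suc K)

{-# OPTIONS --safe #-}
-- Put g i = e_(i+1) for i < N and g i = b for i ≥ N, so that β̂^(L+1) has the digit g (L − j)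
-- at position j.  The coefficient functions supported in [1, L] that are lexicographically at
-- most β̂^(L+1) form a mixed-radix numeration: the digit at L is at most g 0, and when it equals
-- g 0 the remaining digits obey the same rule with g shifted by one.  Listing these numerals in
-- increasing order gives ρ 0 < ρ 1 < ⋯ in which consecutive terms obey the Zeckendorf successor
-- rule and β^(L+1) directly follows β̂^(L+1); if Q_(L+1) is the number of numerals of length L,
-- then Σ ρ(m) Q = m.  Hence the range of ρ is the required Zeckendorf collection and Q is
-- fundamental for it.  Choosing e_k = c_1 + ⋯ + c_k − 1 and b = c_1 + ⋯ + c_(N+1) − 1
-- (non-negative by hypothesis, and e_1 ≥ 1 as c_1 ≥ 2), the counting recursion
-- Q_(L+1) = 1 + Σ_(i<L) g i · Q_(L−i) telescopes into the recurrence, since c_1 = g 0 + 1 and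
-- c_k = g (k − 1) − g (k − 2) for 2 ≤ k ≤ N + 1.

module Submission where

open import Defs
open import Data.Nat using (ℕ; zero; suc; pred; >-nonZero; _+_; _*_; _∸_; _≤_; _<_; _≤ᵇ_; _<ᵇ_; z≤n; s≤s)
open import Data.Nat.Properties
open import Algebra.Properties.CommutativeSemigroup +-commutativeSemigroup using (x∙yz≈y∙xz)
open import Data.Integer as ℤ using (ℤ; +_)
import Data.Integer.Properties as ℤ
open import Data.Integer.Tactic.RingSolver using (solve-∀)
open import Data.Bool using (true; false; if_then_else_)
open import Data.List using (applyUpTo)
open import Data.List.Membership.Propositional.Properties using (∈-applyUpTo⁺)
import Data.List.Relation.Unary.Any as Any
open import Data.Product using (∃; _×_; _,_; proj₁; proj₂)
open import Data.Sum as Sum using (_⊎_; inj₁; inj₂)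
open import Function using (_∘_)
open import Relation.Nullary using (¬_; yes; no; contradiction)
open import Relation.Nullary.Reflects using (ofʸ; ofⁿ)
open import Relation.Binary.Bundles using (Setoid)
open import Relation.Binary.Definitions using (tri<; tri≈; tri>)
open import Relation.Binary.PropositionalEquality
  using (_≡_; _≢_; refl; sym; trans; cong; cong₂; subst; subst₂; _→-setoid_; module ≡-Reasoning)

open Setoid (ℕ →-setoid ℕ) using () renaming (refl to ≗-refl; sym to ≗-sym; trans to ≗-trans)

β-self : ∀ i → β i i ≡ 1
β-self zero    = refl
β-self (suc i) = β-self i

β-other : ∀ i k → i ≢ k → β i k ≡ 0
β-other zero    zero    i≢k = contradiction refl i≢k
β-other zero    (suc k) _   = refl
β-other (suc i) zero    _   = refl
β-other (suc i) (suc k) i≢k = β-other i k (λ i≡k → i≢k (cong suc i≡k))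

β-< : ∀ {i k} → k < i → β i k ≡ 0
β-< {i} {k} k<i = β-other i k (λ i≡k → <-irrefl (sym i≡k) k<i)

β-> : ∀ {i k} → i < k → β i k ≡ 0
β-> {i} {k} i<k = β-other i k (λ i≡k → <-irrefl i≡k i<k)

resFrom-≥ : ∀ {n k} μ → n ≤ k → resFrom n μ k ≡ μ k
resFrom-≥ {n} {k} μ n≤k with n ≤ᵇ k | ≤ᵇ-reflects-≤ n k
... | true  | _        = refl
... | false | ofⁿ n≰k = contradiction n≤k n≰k

resFrom-< : ∀ {n k} μ → k < n → resFrom n μ k ≡ 0
resFrom-< {n} {k} μ k<n with n ≤ᵇ k | ≤ᵇ-reflects-≤ n k
... | true  | ofʸ n≤k = contradiction n≤k (<⇒≱ k<n)
... | false | _       = refl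

resFrom-cong : ∀ n {μ ν} → μ ≗ ν → resFrom n μ ≗ resFrom n ν
resFrom-cong n μ≗ν k with n ≤ᵇ k
... | true  = μ≗ν k
... | false = refl

addDigit : ℕ → ℕ → Coef → Coef
addDigit a p x k = a * β p k + x k

addDigit-cong : ∀ a p {x y} → x ≗ y → addDigit a p x ≗ addDigit a p y
addDigit-cong a p x≗y k = cong (_+_ (a * β p k)) (x≗y k)

SuppIn : ℕ → Coef → Set
SuppIn L x = (x 0 ≡ 0) × (∀ k → L < k → x k ≡ 0)

SuppIn-zeroC : ∀ L → SuppIn L zeroC
SuppIn-zeroC L = refl , λ _ _ → refl

SuppIn-addDigit : ∀ {L x} a → SuppIn L x → SuppIn (suc L) (addDigit a (suc L) x)
SuppIn-addDigit {L} a (x0 , x>L) =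
  cong₂ _+_ (*-zeroʳ a) x0 ,
  λ k L+1<k → cong₂ _+_ (trans (cong (a *_) (β-> L+1<k)) (*-zeroʳ a)) (x>L k (<-trans (n<1+n L) L+1<k))

SuppIn⇒Valid : ∀ {L x} → SuppIn L x → Valid x
SuppIn⇒Valid {L} (x0 , x>L) = x0 , L , x>L

<a-resp : ∀ {μ μ' ν ν'} → μ ≗ μ' → ν ≗ ν' → μ <a ν → μ' <a ν'
<a-resp μ≗μ' ν≗ν' (k , μk<νk , above) =
  k , subst₂ _<_ (μ≗μ' k) (ν≗ν' k) μk<νk ,
  λ j k<j → trans (sym (μ≗μ' j)) (trans (above j k<j) (ν≗ν' j))

<a-irrefl : ∀ {μ ν} → μ ≗ ν → ¬ (μ <a ν)
<a-irrefl μ≗ν (k , μk<νk , _) = <-irrefl (μ≗ν k) μk<νk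

<a-trans : ∀ {μ ν ρ} → μ <a ν → ν <a ρ → μ <a ρ
<a-trans {μ} {ν} {ρ} (k , μk<νk , μ=ν) (l , νl<ρl , ν=ρ) with <-cmp k l
... | tri< k<l _ _ = l , subst (_< ρ l) (sym (μ=ν l k<l)) νl<ρl ,
                     λ j l<j → trans (μ=ν j (<-trans k<l l<j)) (ν=ρ j l<j)
... | tri≈ _ refl _ = k , <-trans μk<νk νl<ρl , λ j k<j → trans (μ=ν j k<j) (ν=ρ j k<j)
... | tri> _ _ l<k = k , subst (μ k <_) (ν=ρ k l<k) μk<νk ,
                     λ j k<j → trans (μ=ν j k<j) (ν=ρ j (<-trans l<k k<j))

sumTo-cong : ∀ M {δ δ'} Q → (∀ k → 1 ≤ k → k ≤ M → δ k ≡ δ' k) → sumTo M δ Q ≡ sumTo M δ' Q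
sumTo-cong zero    Q δ=δ' = refl
sumTo-cong (suc M) Q δ=δ' =
  cong₂ _+_ (sumTo-cong M Q (λ k 1≤k k≤M → δ=δ' k 1≤k (m≤n⇒m≤1+n k≤M)))
            (cong (_* Q (suc M)) (δ=δ' (suc M) (s≤s z≤n) ≤-refl))

sumTo-extend : ∀ d M {δ} Q → (∀ k → M < k → δ k ≡ 0) → sumTo (d + M) δ Q ≡ sumTo M δ Q
sumTo-extend zero    M     Q δ>M = refl
sumTo-extend (suc d) M {δ} Q δ>M = begin
  sumTo (d + M) δ Q + δ (suc (d + M)) * Q (suc (d + M)) ≡⟨ cong (λ t → sumTo (d + M) δ Q + t * Q (suc (d + M)))
                                                                 (δ>M _ (s≤s (m≤n+m M d))) ⟩
  sumTo (d + M) δ Q + 0                                 ≡⟨ +-identityʳ _ ⟩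
  sumTo (d + M) δ Q                                     ≡⟨ sumTo-extend d M Q δ>M ⟩
  sumTo M δ Q                                           ∎
  where open ≡-Reasoning

SumIs-unique : ∀ {δ Q v w} → SumIs δ Q v → SumIs δ Q w → v ≡ w
SumIs-unique {δ} {Q} (M , δ>M , refl) (M' , δ>M' , refl) = begin
  sumTo M δ Q         ≡⟨ sumTo-extend M' M Q δ>M ⟨
  sumTo (M' + M) δ Q  ≡⟨ cong (λ n → sumTo n δ Q) (+-comm M' M) ⟩
  sumTo (M + M') δ Q  ≡⟨ sumTo-extend M M' Q δ>M' ⟩
  sumTo M' δ Q        ∎
  where open ≡-Reasoning

SumIs-resp : ∀ {δ δ' Q v} → δ ≗ δ' → SumIs δ Q v → SumIs δ' Q v
SumIs-resp {Q = Q} δ≗δ' (M , δ>M , sum≡v) =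
  M , (λ k M<k → trans (sym (δ≗δ' k)) (δ>M k M<k)) ,
  trans (sumTo-cong M Q (λ k _ _ → sym (δ≗δ' k))) sum≡v

sumTo-addDigit : ∀ {L x} a Q → SuppIn L x →
  sumTo (suc L) (addDigit a (suc L) x) Q ≡ a * Q (suc L) + sumTo L x Q
sumTo-addDigit {L} {x} a Q (_ , x>L) = begin
  sumTo L (addDigit a (suc L) x) Q + (a * β (suc L) (suc L) + x (suc L)) * Q (suc L)
    ≡⟨ cong₂ (λ s t → s + (a * t + x (suc L)) * Q (suc L)) lower (β-self (suc L)) ⟩
  sumTo L x Q + (a * 1 + x (suc L)) * Q (suc L)
    ≡⟨ cong (λ t → sumTo L x Q + (a * 1 + t) * Q (suc L)) (x>L (suc L) ≤-refl) ⟩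
  sumTo L x Q + (a * 1 + 0) * Q (suc L)
    ≡⟨ cong (λ t → sumTo L x Q + t * Q (suc L)) (trans (+-identityʳ (a * 1)) (*-identityʳ a)) ⟩
  sumTo L x Q + a * Q (suc L)
    ≡⟨ +-comm (sumTo L x Q) (a * Q (suc L)) ⟩
  a * Q (suc L) + sumTo L x Q ∎
  where
  open ≡-Reasoning
  lower : sumTo L (addDigit a (suc L) x) Q ≡ sumTo L x Q
  lower = sumTo-cong L Q λ k _ k≤L →
    trans (cong (λ t → a * t + x k) (β-< (s≤s k≤L))) (cong (_+ x k) (*-zeroʳ a))

n≤m⇒m<n+o⇒m∸n<o : ∀ {m n o} → n ≤ m → m < n + o → m ∸ n < o
n≤m⇒m<n+o⇒m∸n<o {m} {n} {o} n≤m m<n+o = subst (m ∸ n <_) (m+n∸m≡n n o) (∸-monoˡ-< m<n+o n≤m)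

-- Condition (2) of a Zeckendorf collection for a pair μ < ν of consecutive elements,
-- where hat n is the immediate predecessor of β^n.
ZeckStep : (ℕ → Coef) → Coef → Coef → Set
ZeckStep hat μ ν =
  (ν ≗ (β 1 ⊕ μ)) ⊎
  ∃ λ n → (2 ≤ n) × (∀ k → 1 ≤ k → k < n → μ k ≡ hat n k) × (ν ≗ (β n ⊕ resFrom n μ))

module _ {hat : ℕ → Coef} where

  ZeckStep-resp : ∀ {μ μ' ν ν'} → μ ≗ μ' → ν ≗ ν' → ZeckStep hat μ ν → ZeckStep hat μ' ν'
  ZeckStep-resp μ≗μ' ν≗ν' (inj₁ ν≗1+μ) =
    inj₁ λ k → trans (sym (ν≗ν' k)) (trans (ν≗1+μ k) (cong (_+_ (β 1 k)) (μ≗μ' k)))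
  ZeckStep-resp {μ' = μ'} μ≗μ' ν≗ν' (inj₂ (n , 2≤n , μ≡hat , ν≗carry)) =
    inj₂ (n , 2≤n , (λ k 1≤k k<n → trans (sym (μ≗μ' k)) (μ≡hat k 1≤k k<n)) ,
          λ k → trans (sym (ν≗ν' k)) (trans (ν≗carry k) (cong (_+_ (β n k)) (resFrom-cong n μ≗μ' k))))

  ZeckStep⇒<a : ∀ {μ ν} → ZeckStep hat μ ν → μ <a ν
  ZeckStep⇒<a {μ} (inj₁ ν≗1+μ) =
    1 , subst (μ 1 <_) (sym (ν≗1+μ 1)) ≤-refl ,
    λ k 1<k → sym (trans (ν≗1+μ k) (cong (_+ μ k) (β-> 1<k)))
  ZeckStep⇒<a {μ} (inj₂ (n , _ , _ , ν≗carry)) =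
    n , subst (μ n <_) (sym (trans (ν≗carry n) (cong₂ _+_ (β-self n) (resFrom-≥ μ ≤-refl)))) ≤-refl ,
    λ k n<k → sym (trans (ν≗carry k) (cong₂ _+_ (β-> n<k) (resFrom-≥ μ (<⇒≤ n<k))))

  ZeckStep-addDigit : ∀ {L μ ν} a → SuppIn L μ → SuppIn L ν → ZeckStep hat μ ν →
    ZeckStep hat (addDigit a (suc L) μ) (addDigit a (suc L) ν)
  ZeckStep-addDigit {L} {μ} a _ _ (inj₁ ν≗1+μ) =
    inj₁ λ k → trans (cong (_+_ (a * β (suc L) k)) (ν≗1+μ k)) (x∙yz≈y∙xz (a * β (suc L) k) (β 1 k) (μ k))
  ZeckStep-addDigit {L} {μ} {ν} a _ (_ , ν>L) (inj₂ (n , 2≤n , μ≡hat , ν≗carry)) =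
    inj₂ (n , 2≤n , μ'≡hat , ν'≗carry)
    where
    -- the carry creates a nonzero digit at n, which ν has only inside [1, L]
    n≤L : n ≤ L
    n≤L with n ≤? L
    ... | yes n≤L = n≤L
    ... | no  n≰L = contradiction
      (trans (sym (ν>L n (≰⇒> n≰L))) (trans (ν≗carry n) (cong₂ _+_ (β-self n) (resFrom-≥ μ ≤-refl))))
      (λ ())
    low : ∀ {k} → k < n → a * β (suc L) k ≡ 0
    low k<n = trans (cong (a *_) (β-< (<-trans k<n (s≤s n≤L)))) (*-zeroʳ a)
    μ'≡hat : ∀ k → 1 ≤ k → k < n → addDigit a (suc L) μ k ≡ hat n k
    μ'≡hat k 1≤k k<n = trans (cong (_+ μ k) (low k<n)) (μ≡hat k 1≤k k<n)
    ν'≗carry : addDigit a (suc L) ν ≗ (β n ⊕ resFrom n (addDigit a (suc L) μ))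
    ν'≗carry k with n ≤? k
    ... | yes n≤k = begin
      a * β (suc L) k + ν k                      ≡⟨ cong (_+_ (a * β (suc L) k)) (ν≗carry k) ⟩
      a * β (suc L) k + (β n k + resFrom n μ k)  ≡⟨ cong (λ t → a * β (suc L) k + (β n k + t)) (resFrom-≥ μ n≤k) ⟩
      a * β (suc L) k + (β n k + μ k)            ≡⟨ x∙yz≈y∙xz (a * β (suc L) k) (β n k) (μ k) ⟩
      β n k + addDigit a (suc L) μ k             ≡⟨ cong (_+_ (β n k)) (resFrom-≥ (addDigit a (suc L) μ) n≤k) ⟨
      β n k + resFrom n (addDigit a (suc L) μ) k ∎
      where open ≡-Reasoning
    ... | no n≰k = begin
      a * β (suc L) k + ν k                      ≡⟨ cong₂ _+_ (low k<n) (ν≗carry k) ⟩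
      β n k + resFrom n μ k                      ≡⟨ cong (_+_ (β n k)) (resFrom-< μ k<n) ⟩
      β n k + 0                                  ≡⟨ cong (_+_ (β n k)) (resFrom-< (addDigit a (suc L) μ) k<n) ⟨
      β n k + resFrom n (addDigit a (suc L) μ) k ∎
      where open ≡-Reasoning
            k<n = ≰⇒> n≰k

  ZeckStep-carry : ∀ {L u} a → SuppIn L u → (∀ k → 1 ≤ k → k ≤ L → u k ≡ hat (suc L) k) →
    ZeckStep hat (addDigit a (suc L) u) (addDigit (suc a) (suc L) zeroC)
  ZeckStep-carry {zero} {u} a (u0 , u>0) _ = inj₁ λ k → begin
    suc a * β 1 k + 0           ≡⟨ +-identityʳ _ ⟩
    β 1 k + a * β 1 k           ≡⟨ cong (_+_ (β 1 k)) (+-identityʳ _) ⟨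
    β 1 k + (a * β 1 k + 0)     ≡⟨ cong (λ t → β 1 k + (a * β 1 k + t)) (u≡0 k) ⟨
    β 1 k + addDigit a 1 u k    ∎
    where
    open ≡-Reasoning
    u≡0 : ∀ k → u k ≡ 0
    u≡0 zero    = u0
    u≡0 (suc k) = u>0 (suc k) (s≤s z≤n)
  ZeckStep-carry {suc L} {u} a (_ , u>L+1) u≡hat = inj₂ (2 + L , s≤s (s≤s z≤n) , μ≡hat , ν≗carry)
    where
    μ≡hat : ∀ k → 1 ≤ k → k < 2 + L → addDigit a (2 + L) u k ≡ hat (2 + L) k
    μ≡hat k 1≤k (s≤s k≤L+1) = begin
      a * β (2 + L) k + u k  ≡⟨ cong (λ t → a * t + u k) (β-< (s≤s k≤L+1)) ⟩
      a * 0 + u k            ≡⟨ cong (_+ u k) (*-zeroʳ a) ⟩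
      u k                    ≡⟨ u≡hat k 1≤k k≤L+1 ⟩
      hat (2 + L) k          ∎
      where open ≡-Reasoning
    ν≗carry : addDigit (suc a) (2 + L) zeroC ≗ (β (2 + L) ⊕ resFrom (2 + L) (addDigit a (2 + L) u))
    ν≗carry k with 2 + L ≤? k
    ... | yes L+2≤k = begin
      suc a * β (2 + L) k + 0                            ≡⟨ +-identityʳ _ ⟩
      β (2 + L) k + a * β (2 + L) k                      ≡⟨ cong (_+_ (β (2 + L) k)) (+-identityʳ _) ⟨
      β (2 + L) k + (a * β (2 + L) k + 0)                ≡⟨ cong (λ t → β (2 + L) k + (a * β (2 + L) k + t)) (u>L+1 k L+2≤k) ⟨
      β (2 + L) k + addDigit a (2 + L) u k               ≡⟨ cong (_+_ (β (2 + L) k)) (resFrom-≥ (addDigit a (2 + L) u) L+2≤k) ⟨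
      β (2 + L) k + resFrom (2 + L) (addDigit a (2 + L) u) k ∎
      where open ≡-Reasoning
    ... | no L+2≰k = begin
      suc a * β (2 + L) k + 0                            ≡⟨ cong (λ t → suc a * t + 0) (β-< k<L+2) ⟩
      suc a * 0 + 0                                      ≡⟨ cong (_+ 0) (*-zeroʳ (suc a)) ⟩
      0                                                  ≡⟨ cong₂ _+_ (β-< k<L+2) (resFrom-< (addDigit a (2 + L) u) k<L+2) ⟨
      β (2 + L) k + resFrom (2 + L) (addDigit a (2 + L) u) k ∎
      where open ≡-Reasoning
            k<L+2 = ≰⇒> L+2≰k

Valid-resp : ∀ {μ ν} → μ ≗ ν → Valid μ → Valid ν
Valid-resp μ≗ν (μ0 , M , μ>M) = trans (sym (μ≗ν 0)) μ0 , M , λ k M<k → trans (sym (μ≗ν k)) (μ>M k M<k)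

IsImmPred-resp : ∀ {E : Collection} {ν ν' n} → (∀ {μ μ'} → μ ≗ μ' → E μ → E μ') → ν ≗ ν' →
  IsImmPred E ν n → IsImmPred E ν' n
IsImmPred-resp E-resp ν≗ν' (Eν , ν<β , below) =
  E-resp ν≗ν' Eν , <a-resp ν≗ν' ≗-refl ν<β ,
  λ μ Eμ μ<β → Sum.map (λ μ≗ν → ≗-trans μ≗ν ν≗ν') (<a-resp ≗-refl ν≗ν') (below μ Eμ μ<β)

-- An enumeration ρ 0, ρ 1, … obeying the successor rule, and passing through
-- hat (L+1) immediately before β^(L+1), has a Zeckendorf collection as its range.
module RangeOfEnumeration
  {hat : ℕ → Coef} (ρ : ℕ → Coef)
  (ρ-zero : ρ 0 ≗ zeroC)
  (ρ-valid : ∀ m → Valid (ρ m))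
  (ρ-step : ∀ m → ZeckStep hat (ρ m) (ρ (suc m)))
  (pos : ℕ → ℕ)
  (ρ-hat : ∀ L → ρ (pos L) ≗ hat (suc L))
  (ρ-β : ∀ L → ρ (suc (pos L)) ≗ β (suc L))
  where

  Range : Collection
  Range μ = ∃ λ m → μ ≗ ρ m

  Range-resp : ∀ {μ μ'} → μ ≗ μ' → Range μ → Range μ'
  Range-resp μ≗μ' (m , μ≗ρm) = m , ≗-trans (≗-sym μ≗μ') μ≗ρm

  ρ-mono : ∀ {m m'} → m < m' → ρ m <a ρ m'
  ρ-mono {m} {suc m'} m<m'+1 with m<1+n⇒m<n∨m≡n m<m'+1
  ... | inj₁ m<m' = <a-trans (ρ-mono m<m') (ZeckStep⇒<a (ρ-step m'))
  ... | inj₂ refl = ZeckStep⇒<a (ρ-step m)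

  ρ-reflect : ∀ {m m'} → ρ m <a ρ m' → m < m'
  ρ-reflect {m} {m'} ρm<ρm' with <-cmp m m'
  ... | tri< m<m' _ _ = m<m'
  ... | tri≈ _ refl _ = contradiction ρm<ρm' (<a-irrefl ≗-refl)
  ... | tri> _ _ m'<m = contradiction (<a-trans ρm<ρm' (ρ-mono m'<m)) (<a-irrefl ≗-refl)

  range-immPred : ∀ n → 2 ≤ n → IsImmPred Range (hat n) n
  range-immPred (suc L) _ =
    (pos L , ≗-sym (ρ-hat L)) , <a-resp (ρ-hat L) (ρ-β L) (ρ-mono (n<1+n (pos L))) , below
    where
    below : ∀ μ → Range μ → μ <a β (suc L) → μ ≗ hat (suc L) ⊎ μ <a hat (suc L)
    below μ (m , μ≗ρm) μ<β with m<1+n⇒m<n∨m≡n (ρ-reflect (<a-resp μ≗ρm (≗-sym (ρ-β L)) μ<β))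
    ... | inj₁ m<pos = inj₂ (<a-resp (≗-sym μ≗ρm) (ρ-hat L) (ρ-mono m<pos))
    ... | inj₂ refl  = inj₁ (≗-trans μ≗ρm (ρ-hat L))

  range-immSucc : ∀ {μ μ~ m} → μ ≗ ρ m → IsImmSucc Range μ μ~ → μ~ ≗ ρ (suc m)
  range-immSucc {μ} {μ~} {m} μ≗ρm ((m' , μ~≗ρm') , μ<μ~ , least)
    with least (ρ (suc m)) (suc m , ≗-refl) (<a-resp (≗-sym μ≗ρm) ≗-refl (ρ-mono (n<1+n m)))
  ... | inj₁ μ~≗ρm+1 = μ~≗ρm+1
  ... | inj₂ μ~<ρm+1 = contradiction (m<1+n⇒m≤n (ρ-reflect (<a-resp μ~≗ρm' ≗-refl μ~<ρm+1)))
                                     (<⇒≱ (ρ-reflect (<a-resp μ≗ρm μ~≗ρm' μ<μ~)))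

  range-zeckendorf : Zeckendorf Range
  range-zeckendorf = (valid , (0 , ≗-sym ρ-zero) , basis) , finitelyManyBelow , successor
    where
    valid : ∀ μ → Range μ → Valid μ
    valid μ (m , μ≗ρm) = Valid-resp (≗-sym μ≗ρm) (ρ-valid m)

    basis : ∀ i → 1 ≤ i → Range (β i)
    basis (suc L) _ = suc (pos L) , ≗-sym (ρ-β L)

    finitelyManyBelow : ∀ μ → Range μ → ∃ λ Ls → ∀ μ' → Range μ' → μ' <a μ → Any.Any (μ' ≗_) Ls
    finitelyManyBelow μ (m , μ≗ρm) =
      applyUpTo ρ m , λ μ' (m' , μ'≗ρm') μ'<μ →
        Any.map (λ ρm'≡ρi → subst (μ' ≗_) ρm'≡ρi μ'≗ρm')
                (∈-applyUpTo⁺ ρ (ρ-reflect (<a-resp μ'≗ρm' μ≗ρm μ'<μ)))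

    successor : ∀ μ μ~ → Range μ → IsImmSucc Range μ μ~ → ¬ (μ~ ≗ (β 1 ⊕ μ)) →
      ∃ λ n → (2 ≤ n) × ∃ λ ν → IsImmPred Range ν n ×
        (∀ k → 1 ≤ k → k < n → μ k ≡ ν k) × (μ~ ≗ (β n ⊕ resFrom n μ))
    successor μ μ~ (m , μ≗ρm) μ~-succ μ~≠1+μ with ρ-step m | range-immSucc μ≗ρm μ~-succ
    ... | inj₁ ρm+1≗1+ρm | μ~≗ρm+1 = contradiction
            (λ k → trans (μ~≗ρm+1 k) (trans (ρm+1≗1+ρm k) (cong (_+_ (β 1 k)) (sym (μ≗ρm k)))))
            μ~≠1+μ
    ... | inj₂ (n , 2≤n , ρm≡hat , ρm+1≗carry) | μ~≗ρm+1 =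
            n , 2≤n , hat n , range-immPred n 2≤n ,
            (λ k 1≤k k<n → trans (μ≗ρm k) (ρm≡hat k 1≤k k<n)) ,
            λ k → trans (μ~≗ρm+1 k) (trans (ρm+1≗carry k) (cong (_+_ (β n k)) (resFrom-cong n (≗-sym μ≗ρm) k)))

  range-fundamental : ∀ {Q} → (∀ m → SumIs (ρ m) Q m) → Fundamental Range Q
  range-fundamental {Q} ρ-sum = distinct , positive , onto
    where
    value : ∀ {μ m v} → μ ≗ ρ m → SumIs μ Q v → v ≡ m
    value μ≗ρm μ-sum = SumIs-unique μ-sum (SumIs-resp (≗-sym μ≗ρm) (ρ-sum _))

    distinct : ∀ δ δ' v → Range δ → Range δ' → SumIs δ Q v → SumIs δ' Q v → δ ≗ δ'
    distinct δ δ' v (m , δ≗ρm) (m' , δ'≗ρm') δ-sum δ'-sum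
      with trans (sym (value δ≗ρm δ-sum)) (value δ'≗ρm' δ'-sum)
    ... | refl = ≗-trans δ≗ρm (≗-sym δ'≗ρm')

    positive : ∀ δ v → Range δ → ¬ (δ ≗ zeroC) → SumIs δ Q v → 1 ≤ v
    positive δ v (m , δ≗ρm) δ≠0 δ-sum with value δ≗ρm δ-sum
    ... | refl with m
    ...   | zero  = contradiction (≗-trans δ≗ρm ρ-zero) δ≠0
    ...   | suc _ = s≤s z≤n

    onto : ∀ m → 1 ≤ m → ∃ λ δ → Range δ × ¬ (δ ≗ zeroC) × SumIs δ Q m
    onto (suc m) _ = ρ (suc m) , (suc m , ≗-refl) ,
      (λ ρm+1≗0 → contradiction (value (≗-sym ρm+1≗0) (0 , (λ _ _ → refl) , refl)) (λ ())) ,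
      ρ-sum (suc m)

-- Mixed-radix numeration with digit bounds g: the digit at position L+1 of the
-- phase-k numeral runs over [0, g k]; below a digit < g k every phase-0 numeral
-- may follow, below the digit g k only phase-(k+1) numerals.  The largest phase-k
-- numeral of length L is top k L.
module MixedRadix (g : ℕ → ℕ) where

  count : ℕ → ℕ → ℕ
  count k zero    = 1
  count k (suc L) = g k * count 0 L + count (suc k) L

  weight : ℕ → ℕ
  weight n = count 0 (pred n)

  top : ℕ → ℕ → Coef
  top k zero    = zeroC
  top k (suc L) = addDigit (g k) (suc L) (top (suc k) L)

  hat : ℕ → Coef
  hat n = top 0 (pred n)

  -- digits k L m is the m-th phase-k numeral of length L; blocks k L r a m is the
  -- m-th one among those with leading digit in [a, a + r], the last block being
  -- followed by phase-(k+1) numerals.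
  mutual
    digits : ℕ → ℕ → ℕ → Coef
    digits k zero    m = zeroC
    digits k (suc L) m = blocks k L (g k) 0 m

    blocks : ℕ → ℕ → ℕ → ℕ → ℕ → Coef
    blocks k L zero    a m = addDigit a (suc L) (digits (suc k) L m)
    blocks k L (suc r) a m with m <? count 0 L
    ... | yes _ = addDigit a (suc L) (digits 0 L m)
    ... | no  _ = blocks k L r (suc a) (m ∸ count 0 L)

  count-pos : ∀ k L → 1 ≤ count k L
  count-pos k zero    = ≤-refl
  count-pos k (suc L) = ≤-trans (count-pos (suc k) L) (m≤n+m _ _)

  count-suc-pred : ∀ L → suc (pred (count 0 L)) ≡ count 0 L
  count-suc-pred L = suc-pred (count 0 L) {{>-nonZero (count-pos 0 L)}}

  count-first-block : ∀ k L r → count 0 L < suc r * count 0 L + count (suc k) L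
  count-first-block k L r =
    <-≤-trans (m<m+n (count 0 L) (count-pos (suc k) L)) (+-monoˡ-≤ (count (suc k) L) (m≤m+n _ _))

  mutual
    digits-supp : ∀ k L m → SuppIn L (digits k L m)
    digits-supp k zero    m = SuppIn-zeroC 0
    digits-supp k (suc L) m = blocks-supp k L (g k) 0 m

    blocks-supp : ∀ k L r a m → SuppIn (suc L) (blocks k L r a m)
    blocks-supp k L zero    a m = SuppIn-addDigit a (digits-supp (suc k) L m)
    blocks-supp k L (suc r) a m with m <? count 0 L
    ... | yes _ = SuppIn-addDigit a (digits-supp 0 L m)
    ... | no  _ = blocks-supp k L r (suc a) (m ∸ count 0 L)

  mutual
    digits-value : ∀ k L m → m < count k L → sumTo L (digits k L m) weight ≡ m
    digits-value k zero    zero    _         = refl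
    digits-value k zero    (suc m) (s≤s ())
    digits-value k (suc L) m    m<size = blocks-value k L (g k) 0 m m<size

    blocks-value : ∀ k L r a m → m < r * count 0 L + count (suc k) L →
      sumTo (suc L) (blocks k L r a m) weight ≡ a * count 0 L + m
    blocks-value k L zero a m m<size =
      trans (sumTo-addDigit a weight (digits-supp (suc k) L m))
            (cong (_+_ (a * count 0 L)) (digits-value (suc k) L m m<size))
    blocks-value k L (suc r) a m m<size with m <? count 0 L
    ... | yes m<C =
      trans (sumTo-addDigit a weight (digits-supp 0 L m)) (cong (_+_ (a * count 0 L)) (digits-value 0 L m m<C))
    ... | no m≮C = begin
      sumTo (suc L) (blocks k L r (suc a) (m ∸ C)) weight ≡⟨ blocks-value k L r (suc a) (m ∸ C)
                                                                (n≤m⇒m<n+o⇒m∸n<o C≤m (subst (m <_) (+-assoc C _ _) m<size)) ⟩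
      (C + a * C) + (m ∸ C)                               ≡⟨ +-assoc C (a * C) _ ⟩
      C + (a * C + (m ∸ C))                               ≡⟨ x∙yz≈y∙xz C (a * C) (m ∸ C) ⟩
      a * C + (C + (m ∸ C))                               ≡⟨ cong (_+_ (a * C)) (m+[n∸m]≡n C≤m) ⟩
      a * C + m                                           ∎
      where
      open ≡-Reasoning
      C = count 0 L
      C≤m = ≮⇒≥ m≮C

  mutual
    digits-first : ∀ k L → digits k L 0 ≗ zeroC
    digits-first k zero    = ≗-refl
    digits-first k (suc L) = blocks-first k L (g k) 0

    blocks-first : ∀ k L r a → blocks k L r a 0 ≗ addDigit a (suc L) zeroC
    blocks-first k L zero    a = addDigit-cong a (suc L) (digits-first (suc k) L)
    blocks-first k L (suc r) a with 0 <? count 0 L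
    ... | yes _   = addDigit-cong a (suc L) (digits-first 0 L)
    ... | no  0≮C = contradiction (count-pos 0 L) 0≮C

  mutual
    digits-last : ∀ k L {m} → suc m ≡ count k L → digits k L m ≗ top k L
    digits-last k zero    _    = ≗-refl
    digits-last k (suc L) last = blocks-last k L (g k) 0 last

    blocks-last : ∀ k L r a {m} → suc m ≡ r * count 0 L + count (suc k) L →
      blocks k L r a m ≗ addDigit (a + r) (suc L) (top (suc k) L)
    blocks-last k L zero a last j = begin
      addDigit a (suc L) (digits (suc k) L _) j ≡⟨ addDigit-cong a (suc L) (digits-last (suc k) L last) j ⟩
      addDigit a (suc L) (top (suc k) L) j      ≡⟨ cong (λ d → addDigit d (suc L) (top (suc k) L) j) (+-identityʳ a) ⟨
      addDigit (a + 0) (suc L) (top (suc k) L) j ∎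
      where open ≡-Reasoning
    blocks-last k L (suc r) a {m} last with m <? count 0 L
    ... | yes m<C = contradiction (subst (_≤ count 0 L) last m<C) (<⇒≱ (count-first-block k L r))
    ... | no  m≮C = ≗-trans (blocks-last k L r (suc a) last′)
                            (λ j → cong (λ d → addDigit d (suc L) (top (suc k) L) j) (sym (+-suc a r)))
      where
      C = count 0 L
      C≤m = ≮⇒≥ m≮C
      last′ : suc (m ∸ C) ≡ r * C + count (suc k) L
      last′ = begin
        suc (m ∸ C)                          ≡⟨ +-∸-assoc 1 C≤m ⟨
        suc m ∸ C                            ≡⟨ cong (_∸ C) last ⟩
        C + r * C + count (suc k) L ∸ C      ≡⟨ cong (_∸ C) (+-assoc C (r * C) _) ⟩
        C + (r * C + count (suc k) L) ∸ C    ≡⟨ m+n∸m≡n C _ ⟩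
        r * C + count (suc k) L              ∎
        where open ≡-Reasoning

  mutual
    digits-step : ∀ k L m → suc m < count k L → ZeckStep hat (digits k L m) (digits k L (suc m))
    digits-step k zero    m (s≤s ())
    digits-step k (suc L) m m+1<size = blocks-step k L (g k) 0 m m+1<size

    blocks-step : ∀ k L r a m → suc m < r * count 0 L + count (suc k) L →
      ZeckStep hat (blocks k L r a m) (blocks k L r a (suc m))
    blocks-step k L zero a m m+1<size =
      ZeckStep-addDigit a (digits-supp (suc k) L m) (digits-supp (suc k) L (suc m))
                          (digits-step (suc k) L m m+1<size)
    blocks-step k L (suc r) a m m+1<size with m <? count 0 L | suc m <? count 0 L
    ... | yes _   | yes m+1<C =
      ZeckStep-addDigit a (digits-supp 0 L m) (digits-supp 0 L (suc m)) (digits-step 0 L m m+1<C)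
    ... | yes m<C | no  m+1≮C =
      ZeckStep-resp ≗-refl (≗-sym next≗)
        (ZeckStep-carry a (digits-supp 0 L m) (λ j _ _ → digits-last 0 L m+1≡C j))
      where
      m+1≡C : suc m ≡ count 0 L
      m+1≡C = ≤-antisym m<C (≮⇒≥ m+1≮C)
      next≗ : blocks k L r (suc a) (suc m ∸ count 0 L) ≗ addDigit (suc a) (suc L) zeroC
      next≗ = subst (λ i → blocks k L r (suc a) i ≗ addDigit (suc a) (suc L) zeroC)
                    (sym (trans (cong (_∸ count 0 L) m+1≡C) (n∸n≡0 (count 0 L))))
                    (blocks-first k L r (suc a))
    ... | no  m≮C | yes m+1<C = contradiction (<-trans (n<1+n m) m+1<C) m≮C
    ... | no  m≮C | no  _     =
      subst (λ i → ZeckStep hat (blocks k L r (suc a) (m ∸ C)) (blocks k L r (suc a) i))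
            (sym (+-∸-assoc 1 C≤m))
            (blocks-step k L r (suc a) (m ∸ C)
              (subst (_< r * C + count (suc k) L) (+-∸-assoc 1 C≤m)
                     (n≤m⇒m<n+o⇒m∸n<o (≤-trans C≤m (n≤1+n m)) (subst (suc m <_) (+-assoc C _ _) m+1<size))))
      where
      C = count 0 L
      C≤m = ≮⇒≥ m≮C

  top-supp : ∀ k L → SuppIn L (top k L)
  top-supp k zero    = SuppIn-zeroC 0
  top-supp k (suc L) = SuppIn-addDigit (g k) (top-supp (suc k) L)

  top-value : ∀ k L j → 1 ≤ j → j ≤ L → top k L j ≡ g ((L ∸ j) + k)
  top-value k zero    zero    () _
  top-value k zero    (suc j) _  ()
  top-value k (suc L) j 1≤j j≤L+1 with j ≟ suc L
  ... | yes refl = begin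
    g k * β (suc L) (suc L) + top (suc k) L (suc L) ≡⟨ cong₂ (λ b t → g k * b + t) (β-self (suc L)) (proj₂ (top-supp (suc k) L) (suc L) ≤-refl) ⟩
    g k * 1 + 0                                      ≡⟨ trans (+-identityʳ _) (*-identityʳ (g k)) ⟩
    g k                                              ≡⟨ cong (λ i → g (i + k)) (n∸n≡0 L) ⟨
    g ((L ∸ L) + k)                                  ∎
    where open ≡-Reasoning
  ... | no j≢L+1 = begin
    g k * β (suc L) j + top (suc k) L j              ≡⟨ cong (λ b → g k * b + top (suc k) L j) (β-other (suc L) j (j≢L+1 ∘ sym)) ⟩
    g k * 0 + top (suc k) L j                        ≡⟨ cong (_+ top (suc k) L j) (*-zeroʳ (g k)) ⟩
    top (suc k) L j                                  ≡⟨ top-value (suc k) L j 1≤j j≤L ⟩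
    g ((L ∸ j) + suc k)                              ≡⟨ cong g (+-suc (L ∸ j) k) ⟩
    g (suc (L ∸ j) + k)                              ≡⟨ cong (λ i → g (i + k)) (+-∸-assoc 1 j≤L) ⟨
    g ((suc L ∸ j) + k)                              ∎
    where
    open ≡-Reasoning
    j≤L = m<1+n⇒m≤n (≤∧≢⇒< j≤L+1 j≢L+1)

  module Numerals (g0-pos : 1 ≤ g 0) where

    g0-suc : suc (pred (g 0)) ≡ g 0
    g0-suc = suc-pred (g 0) {{>-nonZero g0-pos}}

    blocks-head : ∀ k L r a {m} → m < count 0 L → blocks k L (suc r) a m ≗ addDigit a (suc L) (digits 0 L m)
    blocks-head k L r a {m} m<C with m <? count 0 L
    ... | yes _   = ≗-refl
    ... | no  m≮C = contradiction m<C m≮C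

    digits-extend : ∀ L {m} → m < count 0 L → digits 0 (suc L) m ≗ digits 0 L m
    digits-extend L {m} m<C = subst (λ r → blocks 0 L r 0 m ≗ digits 0 L m)
                                    g0-suc
                                    (blocks-head 0 L (pred (g 0)) 0 m<C)

    count-grows : ∀ L → count 0 L < count 0 (suc L)
    count-grows L = <-≤-trans (m<m+n (count 0 L) (count-pos 1 L))
                              (+-monoˡ-≤ (count 1 L) (subst (_≤ g 0 * count 0 L) (*-identityˡ _) (*-monoˡ-≤ (count 0 L) g0-pos)))

    count-mono : ∀ d L → count 0 L ≤ count 0 (d + L)
    count-mono zero    L = ≤-refl
    count-mono (suc d) L = ≤-trans (count-mono d L) (<⇒≤ (count-grows (d + L)))

    count-above : ∀ L → L < count 0 L
    count-above zero    = ≤-refl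
    count-above (suc L) = <-≤-trans (s≤s (count-above L)) (count-grows L)

    digits-stable : ∀ d L {m} → m < count 0 L → digits 0 (d + L) m ≗ digits 0 L m
    digits-stable zero    L m<C = ≗-refl
    digits-stable (suc d) L m<C =
      ≗-trans (digits-extend (d + L) (<-≤-trans m<C (count-mono d L))) (digits-stable d L m<C)

    digits-β : ∀ L → digits 0 (suc L) (count 0 L) ≗ β (suc L)
    digits-β L = subst (λ r → blocks 0 L r 0 (count 0 L) ≗ β (suc L))
                       g0-suc
                       (second-block (pred (g 0)))
      where
      second-block : ∀ r → blocks 0 L (suc r) 0 (count 0 L) ≗ β (suc L)
      second-block r j with count 0 L <? count 0 L
      ... | yes C<C = contradiction C<C (<-irrefl refl)
      ... | no  _   = begin
        blocks 0 L r 1 (count 0 L ∸ count 0 L) j ≡⟨ cong (λ i → blocks 0 L r 1 i j) (n∸n≡0 (count 0 L)) ⟩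
        blocks 0 L r 1 0 j                       ≡⟨ blocks-first 0 L r 1 j ⟩
        (β (suc L) j + 0) + 0                    ≡⟨ trans (+-identityʳ _) (+-identityʳ _) ⟩
        β (suc L) j                              ∎
        where open ≡-Reasoning

    numeral : ℕ → Coef
    numeral m = digits 0 m m

    numeral-at : ∀ L {m} → m < count 0 L → numeral m ≗ digits 0 L m
    numeral-at L {m} m<C j =
      trans (sym (digits-stable L m (count-above m) j))
            (trans (cong (λ n → digits 0 n m j) (+-comm L m)) (digits-stable m L m<C j))

    numeral-step : ∀ m → ZeckStep hat (numeral m) (numeral (suc m))
    numeral-step m = ZeckStep-resp (≗-sym (numeral-at (suc m) (<-trans (n<1+n m) (count-above (suc m)))))
                                   (≗-sym (numeral-at (suc m) (count-above (suc m))))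
                                   (digits-step 0 (suc m) m (count-above (suc m)))

    numeral-sum : ∀ m → SumIs (numeral m) weight m
    numeral-sum m = m , proj₂ (digits-supp 0 m m) , digits-value 0 m m (count-above m)

    numeral-hat : ∀ L → numeral (pred (count 0 L)) ≗ hat (suc L)
    numeral-hat L = ≗-trans (numeral-at L (subst (pred (count 0 L) <_) (count-suc-pred L) (n<1+n _)))
                            (digits-last 0 L (count-suc-pred L))

    numeral-β : ∀ L → numeral (suc (pred (count 0 L))) ≗ β (suc L)
    numeral-β L = subst (λ i → numeral i ≗ β (suc L)) (sym (count-suc-pred L))
                        (≗-trans (numeral-at (suc L) (count-grows L)) (digits-β L))

    open RangeOfEnumeration numeral ≗-refl (λ m → SuppIn⇒Valid (digits-supp 0 m m)) numeral-step
                            (λ L → pred (count 0 L)) numeral-hat numeral-β public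

zsum-cong : ∀ K {f f'} → (∀ k → f (suc k) ≡ f' (suc k)) → zsum K f ≡ zsum K f'
zsum-cong zero    f=f' = refl
zsum-cong (suc K) f=f' = cong₂ ℤ._+_ (zsum-cong K f=f') (f=f' K)

module Recurrence (g : ℕ → ℕ) (N : ℕ) (c : ℕ → ℤ)
  (g-partialSum : ∀ K → K ≤ N → + g K ≡ zsum (suc K) c ℤ.- + 1)
  (g-eventually : ∀ K → N ≤ K → g K ≡ g N)
  where

  open MixedRadix g

  count-eventually : ∀ k M → N ≤ k → count k M ≡ count N M
  count-eventually k zero    N≤k = refl
  count-eventually k (suc M) N≤k =
    cong₂ (λ a b → a * count 0 M + b) (g-eventually k N≤k)
          (trans (count-eventually (suc k) M (m≤n⇒m≤1+n N≤k)) (sym (count-eventually (suc N) M (n≤1+n N))))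

  count-suc-ℤ : ∀ k M → + count k (suc M) ≡ + g k ℤ.* + count 0 M ℤ.+ + count (suc k) M
  count-suc-ℤ k M = trans (ℤ.pos-+ (g k * count 0 M) (count (suc k) M)) (cong (λ t → t ℤ.+ + count (suc k) M) (ℤ.pos-* (g k) (count 0 M)))

  module _ (L : ℕ) where

    term : ℕ → ℤ
    term k = c k ℤ.* + count 0 (L ∸ k)

    -- Invariant of the partial sums of the recurrence at L = K + u + 1; at K = N the
    -- correction terms cancel against the last term because count stabilises from phase N on.
    partialSum : ∀ K u → K ≤ N → L ≡ K + suc u →
      zsum K term ≡ + count 0 L ℤ.- (+ count K (suc u) ℤ.- + count K u) ℤ.+ (zsum K c ℤ.- + 1) ℤ.* + count 0 u
    partialSum zero    u _   refl = base (+ count 0 (suc u)) (+ count 0 u)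
      where
      base : ∀ x y → + 0 ≡ x ℤ.- (x ℤ.- y) ℤ.+ (+ 0 ℤ.- + 1) ℤ.* y
      base = solve-∀
    partialSum (suc K) w K<N L≡ = begin
      zsum K term ℤ.+ c (suc K) ℤ.* + count 0 (L ∸ suc K)  ≡⟨ cong (λ i → zsum K term ℤ.+ c (suc K) ℤ.* + count 0 i) L-K-1≡ ⟩
      zsum K term ℤ.+ c (suc K) ℤ.* + count 0 (suc w)      ≡⟨ step (+ count 0 L) (zsum K c) (c (suc K)) (+ count 0 (suc w)) (+ count 0 w)
                                                               (+ count (suc K) (suc w)) (+ count (suc K) w)
                                                               (partialSum K (suc w) (<⇒≤ K<N) (trans L≡ (sym (+-suc K (suc w)))))
                                                               (count-suc-ℤ K (suc w)) (count-suc-ℤ K w) (g-partialSum K (<⇒≤ K<N)) ⟩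
      + count 0 L ℤ.- (+ count (suc K) (suc w) ℤ.- + count (suc K) w) ℤ.+ (zsum K c ℤ.+ c (suc K) ℤ.- + 1) ℤ.* + count 0 w ∎
      where
      open ≡-Reasoning
      L-K-1≡ : L ∸ suc K ≡ suc w
      L-K-1≡ = trans (cong (_∸ suc K) L≡) (m+n∸m≡n (suc K) (suc w))
      step : ∀ {S A B G} Q₀ Z cc X Y P R →
        S ≡ Q₀ ℤ.- (A ℤ.- B) ℤ.+ (Z ℤ.- + 1) ℤ.* X → A ≡ G ℤ.* X ℤ.+ P → B ≡ G ℤ.* Y ℤ.+ R → G ≡ Z ℤ.+ cc ℤ.- + 1 →
        S ℤ.+ cc ℤ.* X ≡ Q₀ ℤ.- (P ℤ.- R) ℤ.+ (Z ℤ.+ cc ℤ.- + 1) ℤ.* Y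
      step Q₀ Z cc X Y P R refl refl refl refl = identity Q₀ Z cc X Y P R
        where
        identity : ∀ Q₀ Z cc X Y P R →
          Q₀ ℤ.- ((Z ℤ.+ cc ℤ.- + 1) ℤ.* X ℤ.+ P ℤ.- ((Z ℤ.+ cc ℤ.- + 1) ℤ.* Y ℤ.+ R)) ℤ.+ (Z ℤ.- + 1) ℤ.* X ℤ.+ cc ℤ.* X
            ≡ Q₀ ℤ.- (P ℤ.- R) ℤ.+ (Z ℤ.+ cc ℤ.- + 1) ℤ.* Y
        identity = solve-∀

    fullSum : ∀ u → L ≡ N + suc u → zsum (suc N) term ≡ + count 0 L
    fullSum u L≡ = begin
      zsum N term ℤ.+ c (suc N) ℤ.* + count 0 (L ∸ suc N) ≡⟨ cong (λ i → zsum N term ℤ.+ c (suc N) ℤ.* + count 0 i) L-N-1≡ ⟩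
      zsum N term ℤ.+ c (suc N) ℤ.* + count 0 u           ≡⟨ close (+ count 0 L) (zsum N c) (c (suc N)) (+ count 0 u) (+ count N u)
                                                               (partialSum N u ≤-refl L≡) tail≡ (g-partialSum N ≤-refl) ⟩
      + count 0 L                                     ∎
      where
      open ≡-Reasoning
      L-N-1≡ : L ∸ suc N ≡ u
      L-N-1≡ = trans (cong (_∸ suc N) (trans L≡ (+-suc N u))) (m+n∸m≡n (suc N) u)
      tail≡ : + count N (suc u) ≡ + g N ℤ.* + count 0 u ℤ.+ + count N u
      tail≡ = trans (count-suc-ℤ N u) (cong (λ i → + g N ℤ.* + count 0 u ℤ.+ + i) (count-eventually (suc N) u (n≤1+n N)))
      close : ∀ {S A G} Q₀ Z cc Y R →
        S ≡ Q₀ ℤ.- (A ℤ.- R) ℤ.+ (Z ℤ.- + 1) ℤ.* Y → A ≡ G ℤ.* Y ℤ.+ R → G ≡ Z ℤ.+ cc ℤ.- + 1 → S ℤ.+ cc ℤ.* Y ≡ Q₀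
      close Q₀ Z cc Y R refl refl refl = identity Q₀ Z cc Y R
        where
        identity : ∀ Q₀ Z cc Y R → Q₀ ℤ.- ((Z ℤ.+ cc ℤ.- + 1) ℤ.* Y ℤ.+ R ℤ.- R) ℤ.+ (Z ℤ.- + 1) ℤ.* Y ℤ.+ cc ℤ.* Y ≡ Q₀
        identity = solve-∀

  count-recurrence : ∀ L → N < L → + count 0 L ≡ zsum (suc N) (λ k → c k ℤ.* + count 0 (L ∸ k))
  count-recurrence L N<L = sym (fullSum L (L ∸ suc N) (trans (sym (m+[n∸m]≡n N<L)) (sym (+-suc N (L ∸ suc N)))))

module ZeckendorfFromRecurrence (N : ℕ) (c : ℕ → ℤ)
  (partialSums≥1 : ∀ k → 1 ≤ k → k ≤ suc N → + 1 ℤ.≤ zsum k c)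
  (c₁≥2 : + 2 ℤ.≤ c 1)
  where

  e : ℕ → ℕ
  e k = ℤ.∣ zsum k c ℤ.- + 1 ∣

  b : ℕ
  b = e (suc N)

  -- the guard of hatβ, so that hatβ (L+1) and hat (L+1) agree by computation
  g : ℕ → ℕ
  g i = if suc i ≤ᵇ N then e (suc i) else b

  e≡ : ∀ {k} → 1 ≤ k → k ≤ suc N → + e k ≡ zsum k c ℤ.- + 1
  e≡ 1≤k k≤N+1 = ℤ.0≤i⇒+∣i∣≡i (ℤ.+-monoˡ-≤ (ℤ.- + 1) (partialSums≥1 _ 1≤k k≤N+1))

  g-below : ∀ {i} → i ≤ N → g i ≡ e (suc i)
  g-below {i} i≤N with suc i ≤ᵇ N | ≤ᵇ-reflects-≤ (suc i) N
  ... | true  | _         = refl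
  ... | false | ofⁿ i≮N = cong (e ∘ suc) (≤-antisym (≮⇒≥ i≮N) i≤N)

  g-above : ∀ {i} → N ≤ i → g i ≡ b
  g-above {i} N≤i with suc i ≤ᵇ N | ≤ᵇ-reflects-≤ (suc i) N
  ... | true  | ofʸ i<N = contradiction N≤i (<⇒≱ i<N)
  ... | false | _       = refl

  g-partialSum : ∀ K → K ≤ N → + g K ≡ zsum (suc K) c ℤ.- + 1
  g-partialSum K K≤N = trans (cong +_ (g-below K≤N)) (e≡ (s≤s z≤n) (s≤s K≤N))

  g₀≥1 : 1 ≤ g 0
  g₀≥1 = ℤ.drop‿+≤+ (subst (+ 1 ℤ.≤_) (sym (g-partialSum 0 z≤n))
           (subst (λ t → + 1 ℤ.≤ t ℤ.- + 1) (sym (ℤ.+-identityˡ (c 1))) (ℤ.+-monoˡ-≤ (ℤ.- + 1) c₁≥2)))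

  e₁≥1 : 1 ≤ e 1
  e₁≥1 = subst (1 ≤_) (g-below z≤n) g₀≥1

  open MixedRadix g public
  open Numerals g₀≥1 public
  open Recurrence g N c g-partialSum (λ K N≤K → trans (g-above N≤K) (sym (g-above ≤-refl)))

  weight-pos : ∀ n → 1 ≤ n → 1 ≤ weight n
  weight-pos n _ = count-pos 0 (pred n)

  recurrence : ∀ n → suc (suc N) ≤ n → + weight n ≡ zsum (suc N) (λ k → c k ℤ.* + weight (n ∸ k))
  recurrence (suc L) (s≤s N<L) =
    trans (count-recurrence L N<L)
          (zsum-cong (suc N) λ k → cong (λ i → c (suc k) ℤ.* + count 0 i) (sym (pred[m∸n]≡m∸[1+n] L k)))

  hatβ≗hat : ∀ L → hatβ N e b (suc L) ≗ hat (suc L)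
  hatβ≗hat L zero    = sym (proj₁ (top-supp 0 L))
  hatβ≗hat L (suc j) with j <ᵇ L | <ᵇ-reflects-< j L
  ... | false | ofⁿ j≮L = sym (proj₂ (top-supp 0 L) (suc j) (s≤s (≮⇒≥ j≮L)))
  ... | true  | ofʸ j<L = sym (trans (top-value 0 L (suc j) (s≤s z≤n) j<L)
                                    (cong (λ i → if i ≤ᵇ N then e i else b) digit≡))
    where
    digit≡ : suc ((L ∸ suc j) + 0) ≡ L ∸ j
    digit≡ = trans (cong suc (+-identityʳ _)) (sym (+-∸-assoc 1 j<L))

  predecessors : ∀ n → 2 ≤ n → IsImmPred Range (hatβ N e b n) n
  predecessors (suc L) 2≤n = IsImmPred-resp {n = suc L} Range-resp (≗-sym (hatβ≗hat L)) (range-immPred (suc L) 2≤n)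

theorem2p18 : (N : ℕ) (c : ℕ → ℤ) →
    (∀ k → 1 ≤ k → k ≤ suc N → + 1 ℤ.≤ zsum k c) →
    + 2 ℤ.≤ c 1 →
    ∃ λ (e : ℕ → ℕ) → ∃ λ (b : ℕ) →
      (1 ≤ N → 1 ≤ e 1) ×
      ∃ λ (Q : ℕ → ℕ) →
        (∀ n → 1 ≤ n → 1 ≤ Q n) ×
        (∀ n → suc (suc N) ≤ n → + Q n ≡ zsum (suc N) (λ k → c k ℤ.* + Q (n ∸ k))) ×
        ∃ λ (E : Collection) →
          Zeckendorf E ×
          (∀ n → 2 ≤ n → IsImmPred E (hatβ N e b n) n) ×
          Fundamental E Q
theorem2p18 N c partialSums≥1 c₁≥2 =
  e , b , (λ _ → e₁≥1) , weight , weight-pos , recurrence ,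
  Range , range-zeckendorf , predecessors , range-fundamental numeral-sum
  where open ZeckendorfFromRecurrence N c partialSums≥1 c₁≥2
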